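{- For every $n\ge 1$, the number of integer sequences $e=(e_1,\dots,e_n)$ with $0\le e_i<i$ for all $i\in[n]$ such that there are no indices $i<j<k$ with $e_i<e_j\le e_k$ is $2^{n-1}$. -}

module Defs where

open import Data.Nat using (ℕ; suc; _<_; _≤_)
open import Data.Fin using (Fin; toℕ)
open import Data.Product using (Σ; ∃-syntax; _×_)
open import Relation.Nullary using (¬_)
open import Relation.Binary.PropositionalEquality using (_≡_)

-- An inversion sequence of length n, 0-indexed: position i (i = 0..n-1,
-- corresponding to the paper's index i+1) holds a value e_i with
-- 0 ≤ e_i < i+1, i.e. e_i : Fin (suc i).
InvSeq : ℕ → Set
InvSeq n = (i : Fin n) → Fin (suc (toℕ i))

val : ∀ {n} → InvSeq n → Fin n → ℕ
val e i = toℕ (e i)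

HasPattern : ∀ {n} → InvSeq n → Set
HasPattern {n} e =
  ∃[ i ] ∃[ j ] ∃[ k ]
    (toℕ i < toℕ j × toℕ j < toℕ k × val e i < val e j × val e j ≤ val e k)

Avoids : ∀ {n} → InvSeq n → Set
Avoids e = ¬ HasPattern e

-- Pointwise equality of inversion sequences (avoids needing funext).
_≈ₑ_ : ∀ {n} → InvSeq n → InvSeq n → Set
e ≈ₑ e' = ∀ i → e i ≡ e' i

-- "Exactly m inversion sequences of length n satisfy P": an enumeration
-- f : Fin m → InvSeq n which is injective (up to ≈ₑ), lands in P, and
-- covers every sequence satisfying P.
CountIs : (n : ℕ) → (InvSeq n → Set) → ℕ → Set
CountIs n P m =
  Σ (Fin m → InvSeq n) λ f →
    (∀ a b → f a ≈ₑ f b → a ≡ b) ×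
    (∀ a → P (f a)) ×
    (∀ e → P e → ∃[ a ] f a ≈ₑ e)

module Submission where

open import Defs
open import Data.Nat using (ℕ; zero; suc; pred; _+_; _^_; _∸_; _<_; _≤_; _≥_; z≤n; s≤s; z<s; s<s; _<?_; _≟_; >-nonZero)
open import Data.Nat.Properties
open import Data.Fin as Fin using (Fin; toℕ; fromℕ<; splitAt; _↑ˡ_; _↑ʳ_)
open import Data.Fin.Properties using (toℕ-injective; toℕ-fromℕ<; fromℕ<-toℕ; toℕ<n; splitAt⁻¹-↑ˡ; splitAt⁻¹-↑ʳ; splitAt-↑ˡ; splitAt-↑ʳ)
open import Data.Product using (∃-syntax; _×_; _,_; proj₁; proj₂)
open import Data.Sum using (_⊎_; inj₁; inj₂; [_,_]′)
open import Data.Empty using (⊥-elim)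
open import Relation.Nullary using (¬_; yes; no; contradiction)
open import Relation.Binary.PropositionalEquality

-- Since e₁ = 0, a pattern e_i < e_j ≤ e_k exists iff some positive entry is
-- matched or exceeded later (take i = 1).  So the avoiding sequences are the
-- inversion sequences whose positive entries exceed every later entry.  Such
-- a sequence of length n + 2 either ends in 0, and dropping that entry leaves
-- one of length n + 1; or ends positively, and then dropping the leading 0 and
-- decrementing every entry is a bijection onto the sequences of length n + 1
-- (entries before a positive last entry are 0 or at least 2).  Hence the
-- count doubles with each step.

Seq : Set
Seq = ℕ → ℕ

_≗[_]_ : Seq → ℕ → Seq → Set
g ≗[ n ] h = ∀ k → k < n → g k ≡ h k

IsInversionSeq : ℕ → Seq → Set
IsInversionSeq n g = ∀ k → k < n → g k ≤ k

PositivesExceedLater : ℕ → Seq → Set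
PositivesExceedLater n g = ∀ j k → j < k → k < n → 0 < g j → g k < g j

Admissible : ℕ → Seq → Set
Admissible n g = IsInversionSeq n g × PositivesExceedLater n g

record Enumeration (n : ℕ) (P : Seq → Set) (m : ℕ) : Set where
  field
    enum      : Fin m → Seq
    injective : ∀ a b → enum a ≗[ n ] enum b → a ≡ b
    sound     : ∀ a → P (enum a)
    complete  : ∀ g → P g → ∃[ a ] enum a ≗[ n ] g

enumeration-⊎ : ∀ {n a b} {P Q R : Seq → Set} →
  Enumeration n P a → Enumeration n Q b →
  (∀ g h → P g → Q h → ¬ g ≗[ n ] h) →
  (∀ g → R g → P g ⊎ Q g) → (∀ g → P g → R g) → (∀ g → Q g → R g) →
  Enumeration n R (a + b)
enumeration-⊎ {n} {a} {b} {P} {Q} {R} EP EQ disjoint split P⊆R Q⊆R =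
  record { enum = enum ; injective = injective ; sound = sound ; complete = complete }
  where
  module EP = Enumeration EP
  module EQ = Enumeration EQ

  enum : Fin (a + b) → Seq
  enum c = [ EP.enum , EQ.enum ]′ (splitAt a c)

  injective : ∀ x y → enum x ≗[ n ] enum y → x ≡ y
  injective x y eq with splitAt a x in ex | splitAt a y in ey
  ... | inj₁ x′ | inj₁ y′ rewrite EP.injective x′ y′ eq =
    trans (sym (splitAt⁻¹-↑ˡ ex)) (splitAt⁻¹-↑ˡ ey)
  ... | inj₂ x′ | inj₂ y′ rewrite EQ.injective x′ y′ eq =
    trans (sym (splitAt⁻¹-↑ʳ ex)) (splitAt⁻¹-↑ʳ ey)
  ... | inj₁ x′ | inj₂ y′ = ⊥-elim (disjoint _ _ (EP.sound x′) (EQ.sound y′) eq)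
  ... | inj₂ x′ | inj₁ y′ =
    ⊥-elim (disjoint _ _ (EP.sound y′) (EQ.sound x′) (λ k k<n → sym (eq k k<n)))

  sound : ∀ c → R (enum c)
  sound c with splitAt a c
  ... | inj₁ x = P⊆R _ (EP.sound x)
  ... | inj₂ x = Q⊆R _ (EQ.sound x)

  complete : ∀ g → R g → ∃[ c ] enum c ≗[ n ] g
  complete g r with split g r
  ... | inj₁ p with EP.complete g p
  ...   | x , eq = x ↑ˡ b , subst (λ s → [ EP.enum , EQ.enum ]′ s ≗[ n ] g) (sym (splitAt-↑ˡ a x b)) eq
  complete g r | inj₂ q with EQ.complete g q
  ...   | x , eq = a ↑ʳ x , subst (λ s → [ EP.enum , EQ.enum ]′ s ≗[ n ] g) (sym (splitAt-↑ʳ a b x)) eq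

enumeration-map : ∀ {n n′ c} {P Q : Seq → Set} → Enumeration n P c →
  (φ ψ : Seq → Seq) →
  (∀ g g′ → g ≗[ n ] g′ → φ g ≗[ n′ ] φ g′) →
  (∀ g h → P g → P h → φ g ≗[ n′ ] φ h → g ≗[ n ] h) →
  (∀ g → P g → Q (φ g)) →
  (∀ h → Q h → P (ψ h)) →
  (∀ h → Q h → φ (ψ h) ≗[ n′ ] h) →
  Enumeration n′ Q c
enumeration-map {n′ = n′} {Q = Q} E φ ψ φ-cong φ-injective φ-sound ψ-sound φ∘ψ =
  record
    { enum = λ a → φ (enum a)
    ; injective = λ a b eq → injective a b (φ-injective _ _ (sound a) (sound b) eq)
    ; sound = λ a → φ-sound _ (sound a)
    ; complete = complete′
    }
  where
  open Enumeration E
  complete′ : ∀ h → Q h → ∃[ a ] φ (enum a) ≗[ n′ ] h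
  complete′ h q with complete (ψ h) (ψ-sound h q)
  ... | a , eq = a , λ k k<n′ → trans (φ-cong _ _ eq k k<n′) (φ∘ψ h q k k<n′)

enumeration-length1 : Enumeration 1 (Admissible 1) 1
enumeration-length1 = record
  { enum = λ _ _ → 0
  ; injective = λ { Fin.zero Fin.zero _ → refl }
  ; sound = λ _ → (λ _ _ → z≤n) , λ { j k j<k (s≤s z≤n) _ → ⊥-elim (n≮0 j<k) }
  ; complete = λ g (bounded , _) →
      Fin.zero , λ { zero _ → sym (n≤0⇒n≡0 (bounded 0 z<s)) ; (suc k) (s≤s ()) }
  }

EndsInZero : ℕ → Seq → Set
EndsInZero n h = Admissible (suc n) h × h n ≡ 0

EndsPositive : ℕ → Seq → Set
EndsPositive n h = Admissible (suc n) h × 0 < h n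

truncate : ℕ → Seq → Seq
truncate n g k with k <? n
... | yes _ = g k
... | no  _ = 0

truncate-< : ∀ n g k → k < n → truncate n g k ≡ g k
truncate-< n g k k<n with k <? n
... | yes _ = refl
... | no k≮n = contradiction k<n k≮n

truncate-≥ : ∀ n g k → ¬ k < n → truncate n g k ≡ 0
truncate-≥ n g k k≮n with k <? n
... | yes k<n = contradiction k<n k≮n
... | no  _ = refl

truncate-cong : ∀ n g h → g ≗[ n ] h → truncate n g ≗[ suc n ] truncate n h
truncate-cong n g h eq k _ with k <? n
... | yes k<n = eq k k<n
... | no  _ = refl

admissible-truncate : ∀ n g → Admissible n g → EndsInZero n (truncate n g)
admissible-truncate n g (bounded , exceeds) = (bounded′ , exceeds′) , truncate-≥ n g n (n≮n n)
  where
  bounded′ : IsInversionSeq (suc n) (truncate n g)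
  bounded′ k _ with k <? n
  ... | yes k<n = bounded k k<n
  ... | no  _ = z≤n
  exceeds′ : PositivesExceedLater (suc n) (truncate n g)
  exceeds′ j k j<k _ pos with j <? n | k <? n
  ... | no _     | _        = ⊥-elim (n≮0 pos)
  ... | yes _    | yes k<n  = exceeds j k j<k k<n pos
  ... | yes _    | no _     = pos

endsInZero-restrict : ∀ n h → EndsInZero n h → Admissible n h
endsInZero-restrict n h ((bounded , exceeds) , _) =
  (λ k k<n → bounded k (m<n⇒m<1+n k<n)) ,
  (λ j k j<k k<n → exceeds j k j<k (m<n⇒m<1+n k<n))

truncate-endsInZero : ∀ n h → EndsInZero n h → truncate n h ≗[ suc n ] h
truncate-endsInZero n h (_ , hn≡0) k k<1+n with m<1+n⇒m<n∨m≡n k<1+n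
... | inj₁ k<n  = truncate-< n h k k<n
... | inj₂ refl = trans (truncate-≥ n h n (n≮n n)) (sym hn≡0)

enumeration-endsInZero : ∀ n c → Enumeration n (Admissible n) c → Enumeration (suc n) (EndsInZero n) c
enumeration-endsInZero n c E =
  enumeration-map E (truncate n) (λ h → h) (truncate-cong n) injective (admissible-truncate n)
    (endsInZero-restrict n) (truncate-endsInZero n)
  where
  injective : ∀ g h → Admissible n g → Admissible n h →
    truncate n g ≗[ suc n ] truncate n h → g ≗[ n ] h
  injective g h _ _ eq k k<n =
    trans (sym (truncate-< n g k k<n)) (trans (eq k (m<n⇒m<1+n k<n)) (truncate-< n h k k<n))

bump : ℕ → ℕ
bump zero    = 0
bump (suc v) = suc (suc v)

bump-≤ : ∀ v → bump v ≤ suc v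
bump-≤ zero    = z≤n
bump-≤ (suc v) = ≤-refl

bump-injective : ∀ u v → bump u ≡ bump v → u ≡ v
bump-injective zero    zero    _  = refl
bump-injective (suc u) (suc v) eq = cong pred eq

bump-pred : ∀ v → v ≢ 1 → bump (pred v) ≡ v
bump-pred zero          _   = refl
bump-pred (suc zero)    v≢1 = contradiction refl v≢1
bump-pred (suc (suc v)) _   = refl

raise : ℕ → Seq → Seq
raise m g zero = 0
raise m g (suc j) with j ≟ m
... | yes _ = suc (g j)
... | no  _ = bump (g j)

lower : Seq → Seq
lower h k = pred (h (suc k))

raise-≤ : ∀ m g j → raise m g (suc j) ≤ suc (g j)
raise-≤ m g j with j ≟ m
... | yes _ = ≤-refl
... | no  _ = bump-≤ (g j)

raise-injective : ∀ m g h j → raise m g (suc j) ≡ raise m h (suc j) → g j ≡ h j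
raise-injective m g h j eq with j ≟ m
... | yes _ = suc-injective eq
... | no  _ = bump-injective _ _ eq

raise-cong : ∀ m g h → g ≗[ suc m ] h → raise m g ≗[ suc (suc m) ] raise m h
raise-cong m g h eq zero    _ = refl
raise-cong m g h eq (suc j) (s<s j<1+m) with j ≟ m
... | yes _ = cong suc (eq j j<1+m)
... | no  _ = cong bump (eq j j<1+m)

raise-last : ∀ m g → raise m g (suc m) ≡ suc (g m)
raise-last m g with m ≟ m
... | yes _ = refl
... | no m≢m = contradiction refl m≢m

raise-positive : ∀ m g j → j ≢ m → 0 < raise m g (suc j) →
  raise m g (suc j) ≡ suc (g j) × 0 < g j
raise-positive m g j j≢m pos with j ≟ m
... | yes j≡m = contradiction j≡m j≢m
... | no _ with g j
...   | zero  = ⊥-elim (n≮0 pos)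
...   | suc _ = refl , z<s

admissible-raise : ∀ m g → Admissible (suc m) g → EndsPositive (suc m) (raise m g)
admissible-raise m g (bounded , exceeds) =
  (bounded′ , exceeds′) , subst (0 <_) (sym (raise-last m g)) z<s
  where
  bounded′ : IsInversionSeq (suc (suc m)) (raise m g)
  bounded′ zero    _ = z≤n
  bounded′ (suc j) j<2+m = ≤-trans (raise-≤ m g j) (s≤s (bounded j (≤-pred j<2+m)))
  exceeds′ : PositivesExceedLater (suc (suc m)) (raise m g)
  exceeds′ zero    _       _ _ pos = ⊥-elim (n≮0 pos)
  exceeds′ (suc j) (suc k) (s<s j<k) (s<s k<1+m) pos
    with raise-positive m g j (<⇒≢ (<-≤-trans j<k (≤-pred k<1+m))) pos
  ... | eq , gj>0 = subst (raise m g (suc k) <_) (sym eq)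
                      (≤-<-trans (raise-≤ m g k) (s<s (exceeds j k j<k k<1+m gj>0)))

before-positive-≢1 : ∀ n h j k → PositivesExceedLater n h → j < k → k < n →
  0 < h k → h j ≢ 1
before-positive-≢1 n h j k exceeds j<k k<n hk>0 hj≡1 =
  n≮0 (subst (0 <_) (n<1⇒n≡0 (subst (h k <_) hj≡1 (exceeds j k j<k k<n (subst (0 <_) (sym hj≡1) z<s)))) hk>0)

endsPositive-lower : ∀ m h → EndsPositive (suc m) h → Admissible (suc m) (lower h)
endsPositive-lower m h ((bounded , exceeds) , _) =
  (λ k k<1+m → pred-mono-≤ (bounded (suc k) (s<s k<1+m))) ,
  (λ j k j<k k<1+m pos → pred-< (exceeds (suc j) (suc k) (s<s j<k) (s<s k<1+m) (pred-positive pos)) pos)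
  where
  pred-positive : ∀ {v} → 0 < pred v → 0 < v
  pred-positive {suc _} _ = z<s
  pred-< : ∀ {u v} → u < v → 0 < pred v → pred u < pred v
  pred-< {zero}  _         pos = pos
  pred-< {suc _} (s<s u<v) _   = u<v

raise-lower : ∀ m h → EndsPositive (suc m) h → raise m (lower h) ≗[ suc (suc m) ] h
raise-lower m h ((bounded , _) , _) zero _ = sym (n≤0⇒n≡0 (bounded 0 z<s))
raise-lower m h ((_ , exceeds) , last>0) (suc j) (s<s j<1+m) with j ≟ m
... | yes refl = suc-pred (h (suc m)) {{>-nonZero last>0}}
... | no j≢m   = bump-pred (h (suc j))
  (before-positive-≢1 _ h (suc j) (suc m) exceeds (s<s (≤∧≢⇒< (≤-pred j<1+m) j≢m)) ≤-refl last>0)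

enumeration-endsPositive : ∀ m c → Enumeration (suc m) (Admissible (suc m)) c →
  Enumeration (suc (suc m)) (EndsPositive (suc m)) c
enumeration-endsPositive m c E =
  enumeration-map E (raise m) lower (raise-cong m) injective (admissible-raise m)
    (endsPositive-lower m) (raise-lower m)
  where
  injective : ∀ g h → Admissible (suc m) g → Admissible (suc m) h →
    raise m g ≗[ suc (suc m) ] raise m h → g ≗[ suc m ] h
  injective g h _ _ eq j j<1+m = raise-injective m g h j (eq (suc j) (s<s j<1+m))

enumeration-double : ∀ m c → Enumeration (suc m) (Admissible (suc m)) c →
  Enumeration (suc (suc m)) (Admissible (suc (suc m))) (c + c)
enumeration-double m c E =
  enumeration-⊎ (enumeration-endsInZero (suc m) c E) (enumeration-endsPositive m c E)
    disjoint split (λ _ → proj₁) (λ _ → proj₁)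
  where
  disjoint : ∀ g h → EndsInZero (suc m) g → EndsPositive (suc m) h → ¬ g ≗[ suc (suc m) ] h
  disjoint g h (_ , g≡0) (_ , h>0) eq =
    n≮0 (subst (0 <_) (trans (sym (eq (suc m) ≤-refl)) g≡0) h>0)
  split : ∀ g → Admissible (suc (suc m)) g → EndsInZero (suc m) g ⊎ EndsPositive (suc m) g
  split g adm with g (suc m) ≟ 0
  ... | yes g≡0 = inj₁ (adm , g≡0)
  ... | no  g≢0 = inj₂ (adm , n≢0⇒n>0 g≢0)

enumeration-admissible : ∀ m → Enumeration (suc m) (Admissible (suc m)) (2 ^ m)
enumeration-admissible zero    = enumeration-length1
enumeration-admissible (suc m) =
  subst (Enumeration (suc (suc m)) (Admissible (suc (suc m))))
    (cong (2 ^ m +_) (sym (+-identityʳ (2 ^ m))))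
    (enumeration-double m _ (enumeration-admissible m))

module InversionSequences (m : ℕ) where

  toSeq : InvSeq (suc m) → Seq
  toSeq e k with k <? suc m
  ... | yes k<n = val e (fromℕ< k<n)
  ... | no  _   = 0

  toSeq-val : ∀ e i → toSeq e (toℕ i) ≡ val e i
  toSeq-val e i with toℕ i <? suc m
  ... | yes i<n = cong (val e) (fromℕ<-toℕ i i<n)
  ... | no  i≮n = contradiction (toℕ<n i) i≮n

  toSeq-fromℕ< : ∀ e k (k<n : k < suc m) → toSeq e k ≡ val e (fromℕ< k<n)
  toSeq-fromℕ< e k k<n = trans (cong (toSeq e) (sym (toℕ-fromℕ< k<n))) (toSeq-val e (fromℕ< k<n))

  fromSeq : (g : Seq) → IsInversionSeq (suc m) g → InvSeq (suc m)
  fromSeq g bounded i = fromℕ< (s≤s (bounded (toℕ i) (toℕ<n i)))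

  val-fromSeq : ∀ g bounded i → val (fromSeq g bounded) i ≡ g (toℕ i)
  val-fromSeq g bounded i = toℕ-fromℕ< _

  val-≤ : (e : InvSeq (suc m)) (i : Fin (suc m)) → val e i ≤ toℕ i
  val-≤ e i = ≤-pred (toℕ<n (e i))

  val-zero : (e : InvSeq (suc m)) → val e Fin.zero ≡ 0
  val-zero e with e Fin.zero
  ... | Fin.zero = refl

  toSeq-isInversionSeq : ∀ e → IsInversionSeq (suc m) (toSeq e)
  toSeq-isInversionSeq e k k<n =
    subst₂ _≤_ (sym (toSeq-fromℕ< e k k<n)) (toℕ-fromℕ< k<n) (val-≤ e (fromℕ< k<n))

  avoids⇒positivesExceedLaterᶠ : ∀ e → Avoids e → ∀ j k → toℕ j < toℕ k →
    0 < val e j → val e k < val e j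
  avoids⇒positivesExceedLaterᶠ e avoids j k j<k ej>0 with val e k <? val e j
  ... | yes ek<ej = ek<ej
  ... | no  ek≮ej = ⊥-elim (avoids (Fin.zero , j , k ,
          <-≤-trans ej>0 (val-≤ e j) , j<k , subst (_< val e j) (sym (val-zero e)) ej>0 , ≮⇒≥ ek≮ej))

  avoids⇒positivesExceedLater : ∀ e → Avoids e → PositivesExceedLater (suc m) (toSeq e)
  avoids⇒positivesExceedLater e avoids j k j<k k<n ej>0 =
    subst₂ _<_ (sym (toSeq-fromℕ< e k k<n)) (sym (toSeq-fromℕ< e j j<n))
      (avoids⇒positivesExceedLaterᶠ e avoids (fromℕ< j<n) (fromℕ< k<n)
        (subst₂ _<_ (sym (toℕ-fromℕ< j<n)) (sym (toℕ-fromℕ< k<n)) j<k)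
        (subst (0 <_) (toSeq-fromℕ< e j j<n) ej>0))
    where
    j<n : j < suc m
    j<n = <-trans j<k k<n

  positivesExceedLater⇒avoids : ∀ e g → (∀ i → val e i ≡ g (toℕ i)) →
    PositivesExceedLater (suc m) g → Avoids e
  positivesExceedLater⇒avoids e g e≡g exceeds (i , j , k , i<j , j<k , ei<ej , ej≤ek) =
    <⇒≱ (subst₂ _<_ (sym (e≡g k)) (sym (e≡g j))
      (exceeds (toℕ j) (toℕ k) j<k (toℕ<n k) (subst (0 <_) (e≡g j) (≤-<-trans z≤n ei<ej)))) ej≤ek

  countIs : ∀ c → Enumeration (suc m) (Admissible (suc m)) c → CountIs (suc m) Avoids c
  countIs c E = enum′ , injective′ , sound′ , complete′
    where
    open Enumeration E
    enum′ : Fin c → InvSeq (suc m)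
    enum′ a = fromSeq (enum a) (proj₁ (sound a))
    val-enum′ : ∀ a i → val (enum′ a) i ≡ enum a (toℕ i)
    val-enum′ a = val-fromSeq (enum a) (proj₁ (sound a))
    injective′ : ∀ a b → enum′ a ≈ₑ enum′ b → a ≡ b
    injective′ a b eq = injective a b λ k k<n →
      begin
        enum a k                   ≡⟨ cong (enum a) (toℕ-fromℕ< k<n) ⟨
        enum a (toℕ (fromℕ< k<n))  ≡⟨ val-enum′ a (fromℕ< k<n) ⟨
        val (enum′ a) (fromℕ< k<n) ≡⟨ cong toℕ (eq (fromℕ< k<n)) ⟩
        val (enum′ b) (fromℕ< k<n) ≡⟨ val-enum′ b (fromℕ< k<n) ⟩
        enum b (toℕ (fromℕ< k<n))  ≡⟨ cong (enum b) (toℕ-fromℕ< k<n) ⟩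
        enum b k                   ∎
      where open ≡-Reasoning
    sound′ : ∀ a → Avoids (enum′ a)
    sound′ a = positivesExceedLater⇒avoids (enum′ a) (enum a) (val-enum′ a) (proj₂ (sound a))
    complete′ : ∀ e → Avoids e → ∃[ a ] enum′ a ≈ₑ e
    complete′ e avoids with complete (toSeq e) (toSeq-isInversionSeq e , avoids⇒positivesExceedLater e avoids)
    ... | a , eq = a , λ i → toℕ-injective
      (trans (val-enum′ a i) (trans (eq (toℕ i) (toℕ<n i)) (toSeq-val e i)))

mainTheorem2 : (n : ℕ) → n ≥ 1 → CountIs n Avoids (2 ^ (n ∸ 1))
mainTheorem2 (suc m) _ = InversionSequences.countIs m (2 ^ m) (enumeration-admissible m)
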